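{- For every $n\ge 0$, the restriction of $\mathrm{inc}$ to $R_n(1212)$ is a bijection $R_n(1212)\to R_n(1221)$, and it satisfies $\mathrm{lb}(\mathrm{inc}(w))=\mathrm{lb}(w)$ and $\mathrm{ls}(\mathrm{inc}(w))=\mathrm{ls}(w)$ for all $w\in R_n(1212)$.
   Context: A restricted growth function (RGF) of length $n$ is a sequence $w=w_1\dots w_n$ of positive integers with $w_1=1$ and $w_i\le 1+\max\{w_1,\dots,w_{i-1}\}$ for $i\ge 2$; $R_n$ is the set of RGFs of length $n$. The standardization of a word replaces every occurrence of its smallest letter by $1$, of its next smallest letter by $2$, and so on. An RGF $w$ contains an RGF $v$ if some subword (subsequence, not necessarily consecutive) of $w$ standardizes to $v$; otherwise $w$ avoids $v$; $R_n(v)$ is the set of $w\in R_n$ avoiding $v$. In an RGF $w$, a letter $w_i$ is repeated if $w_j=w_i$ for some $j<i$, and is a first occurrence otherwise. The map $\mathrm{inc}:R_n\to R_n$ sends $w$ to the word obtained by keeping all first occurrences in their positions and rearranging the subword formed by the repeated letters (in the positions they occupy) into weakly increasing order; e.g. $\mathrm{inc}(1112221331)=1112112323$. For a word $w$ and position $j$: $\mathrm{lb}(w_j)$ (resp. $\mathrm{ls}(w_j)$) is the number of distinct values $w_i$ with $i<j$ and $w_i>w_j$ (resp. $w_i<w_j$); $\mathrm{lb}(w)$, $\mathrm{ls}(w)$ are the sums over positions. -}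

module Defs where

open import Data.Nat using (ℕ; zero; suc; _+_; _≤_; _<_; _⊔_; _≤ᵇ_; _<?_; _≟_)
open import Data.Bool using (Bool; true; false; if_then_else_)
open import Data.List using (List; []; _∷_; _++_; [_]; map; filter; length; deduplicate)
open import Data.List.Relation.Binary.Sublist.Propositional using (_⊆_)
open import Data.List.Membership.DecPropositional _≟_ using (_∈?_)
open import Data.Maybe using (Maybe; just; nothing)
open import Data.Product using (Σ; _×_)
open import Relation.Nullary using (¬_; does)
open import Relation.Binary.PropositionalEquality using (_≡_)

-- RGFFrom m w : w continues a restricted growth function whose current
-- maximum is m (m = 0 at the start, forcing w₁ = 1): each letter x is
-- positive and at most 1 + (max of the previous letters).
data RGFFrom : ℕ → List ℕ → Set where
  []  : ∀ {m} → RGFFrom m []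
  _∷_ : ∀ {m x xs} → (1 ≤ x × x ≤ suc m) → RGFFrom (m ⊔ x) xs → RGFFrom m (x ∷ xs)

IsRGF : List ℕ → Set
IsRGF w = RGFFrom 0 w

distinct : List ℕ → List ℕ
distinct = deduplicate _≟_

std : List ℕ → List ℕ
std w = map (λ x → suc (length (filter (_<? x) (distinct w)))) w

Contains : List ℕ → List ℕ → Set
Contains w v = Σ (List ℕ) (λ u → u ⊆ w × std u ≡ v)

Avoids : List ℕ → List ℕ → Set
Avoids w v = ¬ Contains w v

InR : ℕ → List ℕ → List ℕ → Set
InR n v w = IsRGF w × length w ≡ n × Avoids w v

marks : List ℕ → List ℕ → List (Maybe ℕ)
marks seen [] = []
marks seen (x ∷ xs) with does (x ∈? seen)
... | true  = nothing ∷ marks seen xs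
... | false = just x ∷ marks (x ∷ seen) xs

repeats : List ℕ → List ℕ → List ℕ
repeats seen [] = []
repeats seen (x ∷ xs) with does (x ∈? seen)
... | true  = x ∷ repeats seen xs
... | false = repeats (x ∷ seen) xs

insert : ℕ → List ℕ → List ℕ
insert x [] = x ∷ []
insert x (y ∷ ys) = if x ≤ᵇ y then x ∷ y ∷ ys else y ∷ insert x ys

isort : List ℕ → List ℕ
isort [] = []
isort (x ∷ xs) = insert x (isort xs)

fill : List (Maybe ℕ) → List ℕ → List ℕ
fill [] rs = []
fill (just x ∷ ms) rs = x ∷ fill ms rs
fill (nothing ∷ ms) [] = []
fill (nothing ∷ ms) (r ∷ rs) = r ∷ fill ms rs

inc : List ℕ → List ℕ
inc w = fill (marks [] w) (isort (repeats [] w))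

lbFrom : List ℕ → List ℕ → ℕ
lbFrom p [] = 0
lbFrom p (x ∷ xs) = length (filter (x <?_) (distinct p)) + lbFrom (p ++ [ x ]) xs

lsFrom : List ℕ → List ℕ → ℕ
lsFrom p [] = 0
lsFrom p (x ∷ xs) = length (filter (_<? x) (distinct p)) + lsFrom (p ++ [ x ]) xs

lb : List ℕ → ℕ
lb = lbFrom []

ls : List ℕ → ℕ
ls = lsFrom []

p1212 : List ℕ
p1212 = 1 ∷ 2 ∷ 1 ∷ 2 ∷ []

p1221 : List ℕ
p1221 = 1 ∷ 2 ∷ 2 ∷ 1 ∷ []

-- An RGF is determined by its shape (which positions carry first occurrences) together with the
-- word r of its repeated letters, the only constraint being that each repeated letter is at most
-- the current maximum, the cap of its slot.  inc keeps the shape and sorts r.  Avoiding 1221 means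
-- exactly that r is weakly increasing; avoiding 1212 means that r is non-crossing: a repeated letter
-- dominates every later repeated letter that is at most its cap.  For a fixed list of caps, every
-- admissible multiset has exactly one sorted and exactly one non-crossing arrangement (the latter is
-- built greedily), which makes inc a bijection R_n(1212) → R_n(1221).  Finally a repeated letter x
-- below the maximum m sees m − x larger and x − 1 smaller letters, and a first occurrence sees no
-- larger ones, so lb and ls depend only on the shape and on the multiset of repeated letters.

module Submission where

open import Defs
open import Data.Nat using (ℕ; zero; suc; _+_; _∸_; _≤_; _<_; _≤ᵇ_; _<?_; _≤?_; _≟_; z≤n; s≤s; pred)
open import Data.Nat.Properties
open import Data.Bool using (Bool; true; false; T)
open import Data.Unit using (tt)
open import Data.List using (List; []; _∷_; _++_; [_]; map; filter; length)
open import Data.List.Properties using (∷-injective; filter-accept; filter-reject; filter-++; length-++; ++-assoc; ++-identityʳ)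
open import Data.List.Relation.Unary.All as All using (All; []; _∷_)
open import Data.List.Relation.Unary.All.Properties using (all-filter)
open import Data.List.Relation.Unary.AllPairs using (AllPairs; []; _∷_)
open import Data.List.Relation.Unary.Any using (here; there)
open import Data.List.Relation.Binary.Pointwise using (Pointwise; []; _∷_)
open import Data.List.Membership.Propositional using (_∈_; _∉_)
open import Data.List.Membership.Propositional.Properties using (∈-filter⁺; ∈-filter⁻; ∈-deduplicate⁺; ∈-deduplicate⁻; ∈-++⁻; ∈-++⁺ˡ; ∈-++⁺ʳ)
open import Data.List.Membership.DecPropositional _≟_ using (_∈?_)
open import Data.List.Relation.Binary.Sublist.Propositional {A = ℕ} using (_⊆_; []; _∷_; _∷ʳ_; ⊆-refl; ⊆-trans; to∈; from∈)
open import Data.List.Relation.Binary.Sublist.Propositional.Properties using (filter⁺)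
open import Data.List.Relation.Binary.Sublist.Heterogeneous.Properties using (length-mono-≤; ++⁺; ++ʳ)
open import Data.List.Relation.Binary.Permutation.Propositional using (_↭_; ↭-refl; ↭-prep; ↭-swap; ↭-trans; ↭-sym; ↭⇒↭ₛ)
open import Data.List.Relation.Binary.Permutation.Propositional.Properties using (All-resp-↭; ∈-resp-↭; drop-∷; map⁺)
open import Data.List.Relation.Unary.Sorted.TotalOrder.Properties using (AllPairs⇒Sorted; ↗↭↗⇒≋)
open import Data.List.Relation.Binary.Equality.Propositional using (≋⇒≡)
open import Data.List.Extrema.Nat using (max; ⊥≤max; xs≤max; max≤v⁺; argmax-sel)
open import Data.Nat.ListAction using (sum)
open import Data.Nat.ListAction.Properties using (sum-↭)
open import Algebra.Properties.CommutativeSemigroup +-commutativeSemigroup using (interchange; x∙yz≈y∙xz)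
open import Data.Product using (Σ; _×_; _,_; proj₁; proj₂)
open import Data.Sum using (inj₁; inj₂)
open import Relation.Binary.Definitions using (tri<; tri≈; tri>)
open import Function using (_∘_; id)
open import Relation.Nullary using (yes; no; ¬?; contradiction)
open import Relation.Binary.PropositionalEquality using (_≡_; refl; sym; trans; cong; cong₂; subst; subst₂; ≢-sym; module ≡-Reasoning)

-- Decomposing an RGF into its shape and its repeated letters

data Growth : ℕ → List ℕ → Set where
  []  : ∀ {m} → Growth m []
  new : ∀ {m xs} → Growth (suc m) xs → Growth m (suc m ∷ xs)
  old : ∀ {m x xs} → 1 ≤ x → x ≤ m → Growth m xs → Growth m (x ∷ xs)

RGFFrom⇒Growth : ∀ {m w} → RGFFrom m w → Growth m w
RGFFrom⇒Growth [] = []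
RGFFrom⇒Growth {m} {x ∷ xs} ((1≤x , x≤1+m) ∷ r) with x ≤? m
... | yes x≤m = old 1≤x x≤m (RGFFrom⇒Growth (subst (λ k → RGFFrom k xs) (m≥n⇒m⊔n≡m x≤m) r))
... | no x≰m with ≤-antisym x≤1+m (≰⇒> x≰m)
...   | refl = new (RGFFrom⇒Growth (subst (λ k → RGFFrom k xs) (m≤n⇒m⊔n≡n (n≤1+n m)) r))

Growth⇒RGFFrom : ∀ {m w} → Growth m w → RGFFrom m w
Growth⇒RGFFrom [] = []
Growth⇒RGFFrom {m} (new g) =
  (s≤s z≤n , ≤-refl) ∷ subst (λ k → RGFFrom k _) (sym (m≤n⇒m⊔n≡n (n≤1+n m))) (Growth⇒RGFFrom g)
Growth⇒RGFFrom {m} (old 1≤x x≤m g) =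
  (1≤x , m≤n⇒m≤1+n x≤m) ∷ subst (λ k → RGFFrom k _) (sym (m≥n⇒m⊔n≡m x≤m)) (Growth⇒RGFFrom g)

Growth-irrelevant : ∀ {m w} (g h : Growth m w) → g ≡ h
Growth-irrelevant [] [] = refl
Growth-irrelevant (new g) (new h) = cong new (Growth-irrelevant g h)
Growth-irrelevant (new g) (old _ 1+m≤m h) = contradiction 1+m≤m (n≮n _)
Growth-irrelevant (old _ 1+m≤m g) (new h) = contradiction 1+m≤m (n≮n _)
Growth-irrelevant (old p q g) (old p′ q′ h)
  rewrite ≤-irrelevant p p′ | ≤-irrelevant q q′ | Growth-irrelevant g h = refl

shape : ∀ {m w} → Growth m w → List Bool
shape [] = []
shape (new g) = true ∷ shape g
shape (old _ _ g) = false ∷ shape g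

repeated : ∀ {m w} → Growth m w → List ℕ
repeated [] = []
repeated (new g) = repeated g
repeated (old {x = x} _ _ g) = x ∷ repeated g

-- The largest value each repeated-letter slot of a shape may hold.
caps : ℕ → List Bool → List ℕ
caps m [] = []
caps m (true ∷ s) = caps (suc m) s
caps m (false ∷ s) = m ∷ caps m s

assemble : ℕ → List Bool → List ℕ → List ℕ
assemble m [] rs = []
assemble m (true ∷ s) rs = suc m ∷ assemble (suc m) s rs
assemble m (false ∷ s) [] = []
assemble m (false ∷ s) (r ∷ rs) = r ∷ assemble m s rs

assemble-shape-repeated : ∀ {m w} (g : Growth m w) → assemble m (shape g) (repeated g) ≡ w
assemble-shape-repeated [] = refl
assemble-shape-repeated {m} (new g) = cong (suc m ∷_) (assemble-shape-repeated g)
assemble-shape-repeated (old {x = x} _ _ g) = cong (x ∷_) (assemble-shape-repeated g)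

repeated-≤-caps : ∀ {m w} (g : Growth m w) → Pointwise _≤_ (repeated g) (caps m (shape g))
repeated-≤-caps [] = []
repeated-≤-caps (new g) = repeated-≤-caps g
repeated-≤-caps (old _ x≤m g) = x≤m ∷ repeated-≤-caps g

repeated-positive : ∀ {m w} (g : Growth m w) → All (1 ≤_) (repeated g)
repeated-positive [] = []
repeated-positive (new g) = repeated-positive g
repeated-positive (old 1≤x _ g) = 1≤x ∷ repeated-positive g

length-shape : ∀ {m w} (g : Growth m w) → length (shape g) ≡ length w
length-shape [] = refl
length-shape (new g) = cong suc (length-shape g)
length-shape (old _ _ g) = cong suc (length-shape g)

shape-repeated-≡ : ∀ {m w w′} (g : Growth m w) (h : Growth m w′) → w ≡ w′ →
                   shape g ≡ shape h × repeated g ≡ repeated h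
shape-repeated-≡ g h refl rewrite Growth-irrelevant g h = refl , refl

record Assembly (m : ℕ) (s : List Bool) (rs : List ℕ) : Set where
  field
    growth     : Growth m (assemble m s rs)
    shape-≡    : shape growth ≡ s
    repeated-≡ : repeated growth ≡ rs
    length-≡   : length (assemble m s rs) ≡ length s

assembly : ∀ m s rs → Pointwise _≤_ rs (caps m s) → All (1 ≤_) rs → Assembly m s rs
assembly m [] [] [] [] = record { growth = [] ; shape-≡ = refl ; repeated-≡ = refl ; length-≡ = refl }
assembly m (true ∷ s) rs rs≤caps rs-pos = record
  { growth = new growth ; shape-≡ = cong (true ∷_) shape-≡ ; repeated-≡ = repeated-≡ ; length-≡ = cong suc length-≡ }
  where open Assembly (assembly (suc m) s rs rs≤caps rs-pos)
assembly m (false ∷ s) (r ∷ rs) (r≤m ∷ rs≤caps) (1≤r ∷ rs-pos) = record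
  { growth = old 1≤r r≤m growth ; shape-≡ = cong (false ∷_) shape-≡
  ; repeated-≡ = cong (r ∷_) repeated-≡ ; length-≡ = cong suc length-≡ }
  where open Assembly (assembly m s rs rs≤caps rs-pos)

Seen : ℕ → List ℕ → Set
Seen m seen = ∀ y → 1 ≤ y → (y ∈ seen → y ≤ m) × (y ≤ m → y ∈ seen)

Seen-[] : Seen 0 []
Seen-[] y 1≤y = (λ ()) , λ y≤0 → contradiction (≤-trans 1≤y y≤0) (λ ())

Seen-new : ∀ {m seen} → Seen m seen → Seen (suc m) (suc m ∷ seen)
Seen-new {m} seen≈ y 1≤y = bounded , present
  where
  bounded : y ∈ suc m ∷ _ → y ≤ suc m
  bounded (here refl) = ≤-refl
  bounded (there y∈) = m≤n⇒m≤1+n (proj₁ (seen≈ y 1≤y) y∈)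
  present : y ≤ suc m → y ∈ suc m ∷ _
  present y≤1+m with y ≤? m
  ... | yes y≤m = there (proj₂ (seen≈ y 1≤y) y≤m)
  ... | no y≰m = here (≤-antisym y≤1+m (≰⇒> y≰m))

fill-marks : ∀ {m seen w} rs (g : Growth m w) → Seen m seen →
             fill (marks seen w) rs ≡ assemble m (shape g) rs
fill-marks rs [] _ = refl
fill-marks {m} {seen} rs (new g) seen≈ with suc m ∈? seen
... | yes 1+m∈ = contradiction (proj₁ (seen≈ (suc m) (s≤s z≤n)) 1+m∈) (n≮n m)
... | no _ = cong (suc m ∷_) (fill-marks rs g (Seen-new seen≈))
fill-marks {seen = seen} rs (old {x = x} 1≤x x≤m g) seen≈ with x ∈? seen
... | no x∉ = contradiction (proj₂ (seen≈ x 1≤x) x≤m) x∉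
fill-marks [] (old _ _ g) seen≈ | yes _ = refl
fill-marks (r ∷ rs) (old _ _ g) seen≈ | yes _ = cong (r ∷_) (fill-marks rs g seen≈)

repeats-≡-repeated : ∀ {m seen w} (g : Growth m w) → Seen m seen → repeats seen w ≡ repeated g
repeats-≡-repeated [] _ = refl
repeats-≡-repeated {m} {seen} (new g) seen≈ with suc m ∈? seen
... | yes 1+m∈ = contradiction (proj₁ (seen≈ (suc m) (s≤s z≤n)) 1+m∈) (n≮n m)
... | no _ = repeats-≡-repeated g (Seen-new seen≈)
repeats-≡-repeated {seen = seen} (old {x = x} 1≤x x≤m g) seen≈ with x ∈? seen
... | no x∉ = contradiction (proj₂ (seen≈ x 1≤x) x≤m) x∉
... | yes _ = cong (x ∷_) (repeats-≡-repeated g seen≈)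

inc-Growth : ∀ {w} (g : Growth 0 w) → inc w ≡ assemble 0 (shape g) (isort (repeated g))
inc-Growth {w} g rewrite repeats-≡-repeated g Seen-[] = fill-marks (isort (repeated g)) g Seen-[]

Sorted : List ℕ → Set
Sorted = AllPairs _≤_

insert-↭ : ∀ x ys → insert x ys ↭ x ∷ ys
insert-↭ x [] = ↭-refl
insert-↭ x (y ∷ ys) with x ≤ᵇ y
... | true = ↭-refl
... | false = ↭-trans (↭-prep y (insert-↭ x ys)) (↭-swap y x ↭-refl)

isort-↭ : ∀ xs → isort xs ↭ xs
isort-↭ [] = ↭-refl
isort-↭ (x ∷ xs) = ↭-trans (insert-↭ x (isort xs)) (↭-prep x (isort-↭ xs))

≤ᵇ-false⇒> : ∀ {x y} → (x ≤ᵇ y) ≡ false → y < x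
≤ᵇ-false⇒> {x} {y} eq with x ≤? y
... | yes x≤y = contradiction (subst T eq (≤⇒≤ᵇ x≤y)) (λ ())
... | no x≰y = ≰⇒> x≰y

All-≤-trans : ∀ {a b zs} → a ≤ b → All (b ≤_) zs → All (a ≤_) zs
All-≤-trans a≤b = All.map (≤-trans a≤b)

insert-sorted : ∀ x ys → Sorted ys → Sorted (insert x ys)
insert-sorted x [] [] = [] ∷ []
insert-sorted x (y ∷ ys) (y≤ys ∷ ys↗) with x ≤ᵇ y in eq
... | true = (x≤y ∷ All-≤-trans x≤y y≤ys) ∷ y≤ys ∷ ys↗
  where x≤y = ≤ᵇ⇒≤ x y (subst T (sym eq) tt)
... | false = All-resp-↭ (↭-sym (insert-↭ x ys)) (<⇒≤ (≤ᵇ-false⇒> eq) ∷ y≤ys) ∷ insert-sorted x ys ys↗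

isort-sorted : ∀ xs → Sorted (isort xs)
isort-sorted [] = []
isort-sorted (x ∷ xs) = insert-sorted x (isort xs) (isort-sorted xs)

sorted-↭⇒≡ : ∀ {xs ys} → Sorted xs → Sorted ys → xs ↭ ys → xs ≡ ys
sorted-↭⇒≡ xs↗ ys↗ xs↭ys =
  ≋⇒≡ (↗↭↗⇒≋ ≤-totalOrder (AllPairs⇒Sorted ≤-totalOrder xs↗) (AllPairs⇒Sorted ≤-totalOrder ys↗) (↭⇒↭ₛ xs↭ys))

insert-≤-pointwise : ∀ r ys B Bs → Pointwise _≤_ ys Bs → r ≤ B → All (B ≤_) Bs → Sorted Bs →
                     Pointwise _≤_ (insert r ys) (B ∷ Bs)
insert-≤-pointwise r [] B [] [] r≤B _ _ = r≤B ∷ []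
insert-≤-pointwise r (y ∷ ys) B (B′ ∷ Bs) (y≤B′ ∷ ys≤Bs) r≤B (B≤B′ ∷ B≤Bs) (B′≤Bs ∷ Bs↗) with r ≤ᵇ y in eq
... | true = r≤B ∷ y≤B′ ∷ ys≤Bs
... | false = ≤-trans (<⇒≤ (≤ᵇ-false⇒> eq)) r≤B
            ∷ insert-≤-pointwise r ys B′ Bs ys≤Bs (≤-trans r≤B B≤B′) B′≤Bs Bs↗

isort-≤-pointwise : ∀ {rs Bs} → Pointwise _≤_ rs Bs → Sorted Bs → Pointwise _≤_ (isort rs) Bs
isort-≤-pointwise [] _ = []
isort-≤-pointwise {r ∷ rs} {B ∷ Bs} (r≤B ∷ rs≤Bs) (B≤Bs ∷ Bs↗) =
  insert-≤-pointwise r (isort rs) B Bs (isort-≤-pointwise rs≤Bs Bs↗) r≤B B≤Bs Bs↗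

-- Non-crossing arrangements

-- A repeated r under cap B followed later by a repeated v with r < v ≤ B would give r v r v.
data NonCrossing : List ℕ → List ℕ → Set where
  []  : NonCrossing [] []
  _∷_ : ∀ {B Bs r rs} → (∀ {v} → v ∈ rs → v ≤ B → v ≤ r) → NonCrossing Bs rs → NonCrossing (B ∷ Bs) (r ∷ rs)

noncrossing-unique : ∀ {Bs rs rs′} → Pointwise _≤_ rs Bs → Pointwise _≤_ rs′ Bs →
                     NonCrossing Bs rs → NonCrossing Bs rs′ → rs ↭ rs′ → rs ≡ rs′
noncrossing-unique [] [] [] [] _ = refl
noncrossing-unique {B ∷ _} {r ∷ _} {r′ ∷ _} (r≤B ∷ rs≤) (r′≤B ∷ rs′≤) (r-max ∷ nc) (r′-max ∷ nc′) r∷rs↭ =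
  cong₂ _∷_ r≡r′ (noncrossing-unique rs≤ rs′≤ nc nc′ (drop-∷ (subst (λ z → _ ↭ z ∷ _) (sym r≡r′) r∷rs↭)))
  where
  ≤-head : ∀ {a b zs} → (∀ {v} → v ∈ zs → v ≤ B → v ≤ b) → a ≤ B → a ∈ b ∷ zs → a ≤ b
  ≤-head _ _ (here refl) = ≤-refl
  ≤-head b-max a≤B (there a∈) = b-max a∈ a≤B
  r≡r′ : r ≡ r′
  r≡r′ = ≤-antisym (≤-head r′-max r≤B (∈-resp-↭ r∷rs↭ (here refl)))
                   (≤-head r-max r′≤B (∈-resp-↭ (↭-sym r∷rs↭) (here refl)))

largestUpTo : ℕ → ℕ → List ℕ → ℕ
largestUpTo B r₀ rs = max r₀ (filter (_≤? B) rs)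

largestUpTo-∈ : ∀ B r₀ rs → largestUpTo B r₀ rs ∈ r₀ ∷ rs
largestUpTo-∈ B r₀ rs with argmax-sel id r₀ (filter (_≤? B) rs)
... | inj₁ g≡r₀ = here g≡r₀
... | inj₂ g∈ = there (proj₁ (∈-filter⁻ (_≤? B) g∈))

largestUpTo-≤ : ∀ {B r₀} rs → r₀ ≤ B → largestUpTo B r₀ rs ≤ B
largestUpTo-≤ {B} rs r₀≤B = max≤v⁺ r₀≤B (all-filter (_≤? B) rs)

≤-largestUpTo : ∀ {B r₀ rs v} → v ∈ r₀ ∷ rs → v ≤ B → v ≤ largestUpTo B r₀ rs
≤-largestUpTo {B} {r₀} {rs} (here refl) _ = ⊥≤max r₀ (filter (_≤? B) rs)
≤-largestUpTo {B} {r₀} {rs} (there v∈) v≤B = All.lookup (xs≤max r₀ (filter (_≤? B) rs)) (∈-filter⁺ (_≤? B) v∈ v≤B)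

record Replacement (g r₀ : ℕ) (rs Bs : List ℕ) : Set where
  field
    rest    : List ℕ
    ↭-rest  : g ∷ rest ↭ r₀ ∷ rs
    rest-≤  : Pointwise _≤_ rest Bs

replace : ∀ {g r₀ rs Bs} → g ∈ rs → Pointwise _≤_ rs Bs → r₀ ≤ g → Replacement g r₀ rs Bs
replace {g} {r₀} {_ ∷ rs} (here refl) (g≤B ∷ rs≤) r₀≤g =
  record { rest = r₀ ∷ rs ; ↭-rest = ↭-swap g r₀ ↭-refl ; rest-≤ = ≤-trans r₀≤g g≤B ∷ rs≤ }
replace {g} {r₀} {x ∷ _} (there g∈) (x≤B ∷ rs≤) r₀≤g = record
  { rest = x ∷ rest
  ; ↭-rest = ↭-trans (↭-swap g x ↭-refl) (↭-trans (↭-prep x ↭-rest) (↭-swap x r₀ ↭-refl))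
  ; rest-≤ = x≤B ∷ rest-≤ }
  where open Replacement (replace g∈ rs≤ r₀≤g)

record Arrangement (Bs rs : List ℕ) : Set where
  field
    arrangement : List ℕ
    ↭-arrangement : arrangement ↭ rs
    arrangement-≤ : Pointwise _≤_ arrangement Bs
    noncrossing : NonCrossing Bs arrangement

-- Fill the slots left to right, each with the largest remaining value not exceeding its cap.
noncrossing-exists : ∀ {Bs rs} → Pointwise _≤_ rs Bs → Arrangement Bs rs
noncrossing-exists [] = record { arrangement = [] ; ↭-arrangement = ↭-refl ; arrangement-≤ = [] ; noncrossing = [] }
noncrossing-exists {B ∷ Bs} {r₀ ∷ rs} (r₀≤B ∷ rs≤) = record
  { arrangement = g ∷ arrangement
  ; ↭-arrangement = ↭-trans (↭-prep g ↭-arrangement) ↭-rest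
  ; arrangement-≤ = largestUpTo-≤ rs r₀≤B ∷ arrangement-≤
  ; noncrossing = g-max ∷ noncrossing }
  where
  g = largestUpTo B r₀ rs
  rest-of : Replacement g r₀ rs Bs
  rest-of with largestUpTo-∈ B r₀ rs
  ... | here g≡r₀ = record { rest = rs ; ↭-rest = subst (λ z → z ∷ rs ↭ r₀ ∷ rs) (sym g≡r₀) ↭-refl ; rest-≤ = rs≤ }
  ... | there g∈ = replace g∈ rs≤ (⊥≤max r₀ (filter (_≤? B) rs))
  open Replacement rest-of
  open Arrangement (noncrossing-exists rest-≤)
  g-max : ∀ {v} → v ∈ arrangement → v ≤ B → v ≤ g
  g-max v∈ = ≤-largestUpTo (∈-resp-↭ ↭-rest (there (∈-resp-↭ ↭-arrangement v∈)))

rank : List ℕ → ℕ → ℕ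
rank Ds x = length (filter (_<? x) Ds)

rank-mono : ∀ Ds {x y} → x ≤ y → rank Ds x ≤ rank Ds y
rank-mono Ds x≤y = length-mono-≤ (filter⁺ (_<? _) (_<? _) (λ { refl d<x → <-≤-trans d<x x≤y }) (⊆-refl {x = Ds}))

rank-strict : ∀ Ds {x y} → x < y → x ∈ Ds → rank Ds x < rank Ds y
rank-strict (d ∷ Ds) {x} {y} x<y (here refl)
  rewrite filter-reject (_<? x) {x} {Ds} (n≮n x) | filter-accept (_<? y) {x} {Ds} x<y =
  s≤s (rank-mono Ds (<⇒≤ x<y))
rank-strict (d ∷ Ds) {x} {y} x<y (there x∈) with d <? x | d <? y | rank-strict Ds x<y x∈
... | yes d<x | yes d<y | ih rewrite filter-accept (_<? x) {d} {Ds} d<x | filter-accept (_<? y) {d} {Ds} d<y = s≤s ih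
... | yes d<x | no d≮y  | _  = contradiction (<-trans d<x x<y) d≮y
... | no d≮x  | yes d<y | ih rewrite filter-reject (_<? x) {d} {Ds} d≮x | filter-accept (_<? y) {d} {Ds} d<y = m≤n⇒m≤1+n ih
... | no d≮x  | no d≮y  | ih rewrite filter-reject (_<? x) {d} {Ds} d≮x | filter-reject (_<? y) {d} {Ds} d≮y = ih

rank-<⇒< : ∀ Ds {x y} → rank Ds x < rank Ds y → x < y
rank-<⇒< Ds {x} {y} rx<ry with x <? y
... | yes x<y = x<y
... | no x≮y = contradiction (rank-mono Ds (≮⇒≥ x≮y)) (<⇒≱ rx<ry)

rank-injective : ∀ Ds {x y} → x ∈ Ds → y ∈ Ds → rank Ds x ≡ rank Ds y → x ≡ y
rank-injective Ds {x} {y} x∈ y∈ rx≡ry with <-cmp x y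
... | tri< x<y _ _ = contradiction rx≡ry (<⇒≢ (rank-strict Ds x<y x∈))
... | tri≈ _ x≡y _ = x≡y
... | tri> _ _ y<x = contradiction (sym rx≡ry) (<⇒≢ (rank-strict Ds y<x y∈))

std-≡-4 : ∀ u {p q r t} → std u ≡ suc p ∷ suc q ∷ suc r ∷ suc t ∷ [] →
  Σ ℕ λ a → Σ ℕ λ b → Σ ℕ λ c → Σ ℕ λ d → u ≡ a ∷ b ∷ c ∷ d ∷ [] ×
    let R = rank (distinct u) in R a ≡ p × R b ≡ q × R c ≡ r × R d ≡ t
std-≡-4 (a ∷ b ∷ c ∷ d ∷ []) eq
  with ∷-injective eq
... | a≡ , eq₁ with ∷-injective eq₁
... | b≡ , eq₂ with ∷-injective eq₂
... | c≡ , eq₃ with ∷-injective eq₃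
... | d≡ , _ = a , b , c , d , refl , suc-injective a≡ , suc-injective b≡ , suc-injective c≡ , suc-injective d≡
std-≡-4 [] ()
std-≡-4 (_ ∷ []) ()
std-≡-4 (_ ∷ _ ∷ []) ()
std-≡-4 (_ ∷ _ ∷ _ ∷ []) ()
std-≡-4 (_ ∷ _ ∷ _ ∷ _ ∷ _ ∷ _) ()

rank-distinct-injective : ∀ u {x y} → x ∈ u → y ∈ u → rank (distinct u) x ≡ rank (distinct u) y → x ≡ y
rank-distinct-injective u x∈ y∈ = rank-injective (distinct u) (∈-deduplicate⁺ _≟_ x∈) (∈-deduplicate⁺ _≟_ y∈)

std⁻¹-1212 : ∀ u → std u ≡ p1212 → Σ ℕ λ a → Σ ℕ λ b → u ≡ a ∷ b ∷ a ∷ b ∷ [] × a < b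
std⁻¹-1212 u eq with std-≡-4 u eq
... | a , b , c , d , refl , ra , rb , rc , rd =
  a , b , cong₂ (λ x y → a ∷ b ∷ x ∷ y ∷ []) (sym a≡c) (sym b≡d) , rank-<⇒< (distinct u) (subst₂ _<_ (sym ra) (sym rb) ≤-refl)
  where
  a≡c = rank-distinct-injective u (here refl) (there (there (here refl))) (trans ra (sym rc))
  b≡d = rank-distinct-injective u (there (here refl)) (there (there (there (here refl)))) (trans rb (sym rd))

std⁻¹-1221 : ∀ u → std u ≡ p1221 → Σ ℕ λ a → Σ ℕ λ b → u ≡ a ∷ b ∷ b ∷ a ∷ [] × a < b
std⁻¹-1221 u eq with std-≡-4 u eq
... | a , b , c , d , refl , ra , rb , rc , rd =
  a , b , cong₂ (λ x y → a ∷ b ∷ x ∷ y ∷ []) (sym b≡c) (sym a≡d) , rank-<⇒< (distinct u) (subst₂ _<_ (sym ra) (sym rb) ≤-refl)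
  where
  b≡c = rank-distinct-injective u (there (here refl)) (there (there (here refl))) (trans rb (sym rc))
  a≡d = rank-distinct-injective u (here refl) (there (there (there (here refl)))) (trans ra (sym rd))

ranks-of-pair : ∀ {a b} → a < b → rank (a ∷ b ∷ []) a ≡ 0 × rank (a ∷ b ∷ []) b ≡ 1
ranks-of-pair {a} {b} a<b
  rewrite filter-reject (_<? a) {a} {b ∷ []} (n≮n a)
        | filter-reject (_<? a) {b} {[]} (<⇒≯ a<b)
        | filter-accept (_<? b) {a} {b ∷ []} a<b
        | filter-reject (_<? b) {b} {[]} (n≮n b) = refl , refl

distinct-abab : ∀ {a b} → a < b → distinct (a ∷ b ∷ a ∷ b ∷ []) ≡ a ∷ b ∷ []
distinct-abab {a} {b} a<b
  rewrite filter-accept (λ z → ¬? (a ≟ z)) {b} {[]} (<⇒≢ a<b)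
        | filter-accept (λ z → ¬? (b ≟ z)) {a} {b ∷ []} (≢-sym (<⇒≢ a<b))
        | filter-reject (λ z → ¬? (b ≟ z)) {b} {[]} (λ b≢b → b≢b refl)
        | filter-accept (λ z → ¬? (a ≟ z)) {b} {a ∷ []} (<⇒≢ a<b)
        | filter-reject (λ z → ¬? (a ≟ z)) {a} {[]} (λ a≢a → a≢a refl) = refl

distinct-abba : ∀ {a b} → a < b → distinct (a ∷ b ∷ b ∷ a ∷ []) ≡ a ∷ b ∷ []
distinct-abba {a} {b} a<b
  rewrite filter-accept (λ z → ¬? (b ≟ z)) {a} {[]} (≢-sym (<⇒≢ a<b))
        | filter-reject (λ z → ¬? (b ≟ z)) {b} {a ∷ []} (λ b≢b → b≢b refl)
        | filter-accept (λ z → ¬? (b ≟ z)) {a} {[]} (≢-sym (<⇒≢ a<b))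
        | filter-accept (λ z → ¬? (a ≟ z)) {b} {a ∷ []} (<⇒≢ a<b)
        | filter-reject (λ z → ¬? (a ≟ z)) {a} {[]} (λ a≢a → a≢a refl) = refl

std-abab : ∀ {a b} → a < b → std (a ∷ b ∷ a ∷ b ∷ []) ≡ p1212
std-abab {a} {b} a<b = trans
  (cong (λ Ds → map (λ z → suc (rank Ds z)) (a ∷ b ∷ a ∷ b ∷ [])) (distinct-abab a<b))
  (cong₂ (λ p q → suc p ∷ suc q ∷ suc p ∷ suc q ∷ []) (proj₁ (ranks-of-pair a<b)) (proj₂ (ranks-of-pair a<b)))

std-abba : ∀ {a b} → a < b → std (a ∷ b ∷ b ∷ a ∷ []) ≡ p1221
std-abba {a} {b} a<b = trans
  (cong (λ Ds → map (λ z → suc (rank Ds z)) (a ∷ b ∷ b ∷ a ∷ [])) (distinct-abba a<b))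
  (cong₂ (λ p q → suc p ∷ suc q ∷ suc q ∷ suc p ∷ []) (proj₁ (ranks-of-pair a<b)) (proj₂ (ranks-of-pair a<b)))

-- Pattern avoidance in terms of the repeated letters

oneTo : ℕ → List ℕ
oneTo zero = []
oneTo (suc m) = oneTo m ++ [ suc m ]

∈-oneTo⁻ : ∀ {y} m → y ∈ oneTo m → 1 ≤ y × y ≤ m
∈-oneTo⁻ (suc m) y∈ with ∈-++⁻ (oneTo m) y∈
... | inj₁ y∈′ = let (1≤y , y≤m) = ∈-oneTo⁻ m y∈′ in 1≤y , m≤n⇒m≤1+n y≤m
... | inj₂ (here refl) = s≤s z≤n , ≤-refl

∈-oneTo⁺ : ∀ {y} m → 1 ≤ y → y ≤ m → y ∈ oneTo m
∈-oneTo⁺ zero 1≤y y≤0 = contradiction (≤-trans 1≤y y≤0) (λ ())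
∈-oneTo⁺ {y} (suc m) 1≤y y≤1+m with y ≤? m
... | yes y≤m = ∈-++⁺ˡ (∈-oneTo⁺ m 1≤y y≤m)
... | no y≰m rewrite ≤-antisym y≤1+m (≰⇒> y≰m) = ∈-++⁺ʳ (oneTo m) (here refl)

pair-⊆-oneTo : ∀ {x v} m → 1 ≤ x → x < v → v ≤ m → (x ∷ v ∷ []) ⊆ oneTo m
pair-⊆-oneTo zero 1≤x x<v v≤0 = contradiction (≤-trans (≤-trans 1≤x (<⇒≤ x<v)) v≤0) (λ ())
pair-⊆-oneTo {x} {v} (suc m) 1≤x x<v v≤1+m with v ≤? m
... | yes v≤m = ++ʳ [ suc m ] (pair-⊆-oneTo m 1≤x x<v v≤m)
... | no v≰m with ≤-antisym v≤1+m (≰⇒> v≰m)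
...   | refl = ++⁺ (from∈ (∈-oneTo⁺ m 1≤x (≤-pred x<v))) (refl ∷ [])

repeated-⊆-word : ∀ {m w} (g : Growth m w) → repeated g ⊆ w
repeated-⊆-word [] = []
repeated-⊆-word {m} (new g) = suc m ∷ʳ repeated-⊆-word g
repeated-⊆-word (old _ _ g) = refl ∷ repeated-⊆-word g

⊆-repeated : ∀ {m w u} (g : Growth m w) → u ⊆ w → All (_≤ m) u → u ⊆ repeated g
⊆-repeated [] [] _ = []
⊆-repeated (new g) (_ ∷ʳ u⊆w) u≤m = ⊆-repeated g u⊆w (All.map m≤n⇒m≤1+n u≤m)
⊆-repeated (new g) (refl ∷ _) (1+m≤m ∷ _) = contradiction 1+m≤m (n≮n _)
⊆-repeated (old _ _ g) (x ∷ʳ u⊆w) u≤m = x ∷ʳ ⊆-repeated g u⊆w u≤m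
⊆-repeated (old _ _ g) (refl ∷ u⊆w) (_ ∷ u≤m) = refl ∷ ⊆-repeated g u⊆w u≤m

∈-repeated : ∀ {m w v} (g : Growth m w) → v ∈ w → v ≤ m → v ∈ repeated g
∈-repeated g v∈w v≤m = to∈ (⊆-repeated g (from∈ v∈w) (v≤m ∷ []))

sorted-⊆⇒≤ : ∀ {xs y z} → Sorted xs → (y ∷ z ∷ []) ⊆ xs → y ≤ z
sorted-⊆⇒≤ (_ ∷ xs↗) (_ ∷ʳ yz⊆) = sorted-⊆⇒≤ xs↗ yz⊆
sorted-⊆⇒≤ (y≤xs ∷ _) (refl ∷ z⊆) = All.lookup y≤xs (to∈ z⊆)

NonCrossingGrowth : ∀ {m w} → Growth m w → Set
NonCrossingGrowth {m} g = NonCrossing (caps m (shape g)) (repeated g)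

noncrossing-⊆⇒≥ : ∀ {m w a b} (g : Growth m w) → NonCrossingGrowth g → (a ∷ b ∷ []) ⊆ w → a ≤ m → b ≤ m → b ≤ a
noncrossing-⊆⇒≥ (new g) nc (_ ∷ʳ ab⊆) a≤m b≤m = noncrossing-⊆⇒≥ g nc ab⊆ (m≤n⇒m≤1+n a≤m) (m≤n⇒m≤1+n b≤m)
noncrossing-⊆⇒≥ (old _ _ g) (_ ∷ nc) (_ ∷ʳ ab⊆) a≤m b≤m = noncrossing-⊆⇒≥ g nc ab⊆ a≤m b≤m
noncrossing-⊆⇒≥ (new g) nc (refl ∷ _) 1+m≤m _ = contradiction 1+m≤m (n≮n _)
noncrossing-⊆⇒≥ (old _ _ g) (x-max ∷ _) (refl ∷ b⊆) _ b≤m = x-max (∈-repeated g (to∈ b⊆) b≤m) b≤m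

record Tail {m w} (g : Growth m w) : Set where
  field
    m′          : ℕ
    w′          : List ℕ
    growth      : Growth m′ w′
    repeated-⊆  : repeated growth ⊆ repeated g
    noncrossing : NonCrossingGrowth g → NonCrossingGrowth growth

tail-new : ∀ {m xs} (g : Growth (suc m) xs) → Tail (new g)
tail-new {m} g = record
  { m′ = suc m ; w′ = _ ; growth = g ; repeated-⊆ = ⊆-refl ; noncrossing = λ nc → nc }

tail-old : ∀ {m x xs} (1≤x : 1 ≤ x) (x≤m : x ≤ m) (g : Growth m xs) → Tail (old 1≤x x≤m g)
tail-old {m} {x} _ _ g = record
  { m′ = m ; w′ = _ ; growth = g ; repeated-⊆ = x ∷ʳ ⊆-refl ; noncrossing = λ { (_ ∷ nc) → nc } }

Tail-trans : ∀ {m w} {g : Growth m w} (t : Tail g) → Tail (Tail.growth t) → Tail g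
Tail-trans t t′ = record
  { m′ = m′ t′ ; w′ = w′ t′ ; growth = growth t′
  ; repeated-⊆ = ⊆-trans (repeated-⊆ t′) (repeated-⊆ t) ; noncrossing = λ nc → noncrossing t′ (noncrossing t nc) }
  where open Tail

tail-after : ∀ {m w c u} (g : Growth m w) → (c ∷ u) ⊆ w → Σ (Tail g) λ t → u ⊆ Tail.w′ t × c ≤ Tail.m′ t
tail-after (new g) (_ ∷ʳ cu⊆) = let (t , u⊆ , c≤) = tail-after g cu⊆ in Tail-trans (tail-new g) t , u⊆ , c≤
tail-after (old p q g) (_ ∷ʳ cu⊆) = let (t , u⊆ , c≤) = tail-after g cu⊆ in Tail-trans (tail-old p q g) t , u⊆ , c≤
tail-after (new g) (refl ∷ u⊆) = tail-new g , u⊆ , ≤-refl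
tail-after (old p q g) (refl ∷ u⊆) = tail-old p q g , u⊆ , q

noncrossing⇒avoids-1212 : ∀ {w} (g : Growth 0 w) → NonCrossingGrowth g → Avoids w p1212
noncrossing⇒avoids-1212 g nc (u , u⊆w , std-u) with std⁻¹-1212 u std-u
... | a , b , refl , a<b with tail-after g u⊆w
... | t₁ , bab⊆ , _ with tail-after (Tail.growth t₁) bab⊆
... | t₂ , ab⊆ , b≤m₂ = <⇒≱ a<b
  (noncrossing-⊆⇒≥ (Tail.growth t₂) (Tail.noncrossing t₂ (Tail.noncrossing t₁ nc)) ab⊆ (≤-trans (<⇒≤ a<b) b≤m₂) b≤m₂)

sorted⇒avoids-1221 : ∀ {w} (g : Growth 0 w) → Sorted (repeated g) → Avoids w p1221
sorted⇒avoids-1221 g rs↗ (u , u⊆w , std-u) with std⁻¹-1221 u std-u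
... | a , b , refl , a<b with tail-after g u⊆w
... | t₁ , bba⊆ , _ with tail-after (Tail.growth t₁) bba⊆
... | t₂ , ba⊆ , b≤m₂ = <⇒≱ a<b (sorted-⊆⇒≤ rs↗ ba⊆repeated)
  where
  ba⊆repeated = ⊆-trans (⊆-repeated (Tail.growth t₂) ba⊆ (b≤m₂ ∷ ≤-trans (<⇒≤ a<b) b≤m₂ ∷ []))
                        (⊆-trans (Tail.repeated-⊆ t₂) (Tail.repeated-⊆ t₁))

Avoids-++-∷ : ∀ {v} p x xs → Avoids (p ++ x ∷ xs) v → Avoids ((p ++ [ x ]) ++ xs) v
Avoids-++-∷ {v} p x xs = subst (λ z → Avoids z v) (sym (++-assoc p [ x ] xs))

-- The prefix p contains the first occurrences 1, …, m in order, so any x < v ≤ m can be found in it as x v.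
avoids-1212⇒noncrossing : ∀ {m w} p → oneTo m ⊆ p → Avoids (p ++ w) p1212 → (g : Growth m w) → NonCrossingGrowth g
avoids-1212⇒noncrossing p _ _ [] = []
avoids-1212⇒noncrossing {m} p 1…m⊆p av (new {xs = xs} g) =
  avoids-1212⇒noncrossing (p ++ [ suc m ]) (++⁺ 1…m⊆p (refl ∷ [])) (Avoids-++-∷ p (suc m) xs av) g
avoids-1212⇒noncrossing {m} p 1…m⊆p av (old {x = x} {xs} 1≤x x≤m g) =
  x-max ∷ avoids-1212⇒noncrossing (p ++ [ x ]) (++ʳ [ x ] 1…m⊆p) (Avoids-++-∷ p x xs av) g
  where
  x-max : ∀ {v} → v ∈ repeated g → v ≤ m → v ≤ x
  x-max {v} v∈ v≤m with v ≤? x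
  ... | yes v≤x = v≤x
  ... | no v≰x = contradiction
        ((x ∷ v ∷ x ∷ v ∷ []) ,
         ++⁺ (⊆-trans (pair-⊆-oneTo m 1≤x (≰⇒> v≰x) v≤m) 1…m⊆p) (refl ∷ ⊆-trans (from∈ v∈) (repeated-⊆-word g)) ,
         std-abab (≰⇒> v≰x)) av

avoids-1221⇒sorted : ∀ {m w} p → oneTo m ⊆ p → Avoids (p ++ w) p1221 → (g : Growth m w) → Sorted (repeated g)
avoids-1221⇒sorted p _ _ [] = []
avoids-1221⇒sorted {m} p 1…m⊆p av (new {xs = xs} g) =
  avoids-1221⇒sorted (p ++ [ suc m ]) (++⁺ 1…m⊆p (refl ∷ [])) (Avoids-++-∷ p (suc m) xs av) g
avoids-1221⇒sorted {m} p 1…m⊆p av (old {x = x} {xs} 1≤x x≤m g) =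
  All.tabulate x-min ∷ avoids-1221⇒sorted (p ++ [ x ]) (++ʳ [ x ] 1…m⊆p) (Avoids-++-∷ p x xs av) g
  where
  x-min : ∀ {v} → v ∈ repeated g → x ≤ v
  x-min {v} v∈ with x ≤? v
  ... | yes x≤v = x≤v
  ... | no x≰v = contradiction
        ((v ∷ x ∷ x ∷ v ∷ []) ,
         ++⁺ (⊆-trans (pair-⊆-oneTo m (All.lookup (repeated-positive g) v∈) (≰⇒> x≰v) x≤m) 1…m⊆p)
             (refl ∷ ⊆-trans (from∈ v∈) (repeated-⊆-word g)) ,
         std-abba (≰⇒> x≰v)) av

-- The statistics lb and ls

distinct-∷ʳ-∉ : ∀ {x} p → x ∉ p → distinct (p ++ [ x ]) ≡ distinct p ++ [ x ]
distinct-∷ʳ-∉ [] _ = refl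
distinct-∷ʳ-∉ {x} (y ∷ p) x∉ rewrite distinct-∷ʳ-∉ p (λ x∈ → x∉ (there x∈))
  | filter-++ (λ z → ¬? (y ≟ z)) (distinct p) [ x ]
  | filter-accept (λ z → ¬? (y ≟ z)) {x} {[]} (λ y≡x → x∉ (here (sym y≡x))) = refl

distinct-∷ʳ-∈ : ∀ {x} p → x ∈ p → distinct (p ++ [ x ]) ≡ distinct p
distinct-∷ʳ-∈ (y ∷ p) (there x∈) rewrite distinct-∷ʳ-∈ p x∈ = refl
distinct-∷ʳ-∈ {x} (x ∷ p) (here refl) with x ∈? p
... | yes x∈ rewrite distinct-∷ʳ-∈ p x∈ = refl
... | no x∉ rewrite distinct-∷ʳ-∉ p x∉
  | filter-++ (λ z → ¬? (x ≟ z)) (distinct p) [ x ]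
  | filter-reject (λ z → ¬? (x ≟ z)) {x} {[]} (λ x≢x → x≢x refl)
  | ++-identityʳ (filter (λ z → ¬? (x ≟ z)) (distinct p)) = refl

count-above-oneTo : ∀ x m → length (filter (x <?_) (oneTo m)) ≡ m ∸ x
count-above-oneTo x zero = sym (0∸n≡0 x)
count-above-oneTo x (suc m)
  rewrite filter-++ (x <?_) (oneTo m) [ suc m ] | length-++ (filter (x <?_) (oneTo m)) {filter (x <?_) [ suc m ]}
  with x ≤? m
... | yes x≤m rewrite filter-accept (x <?_) {suc m} {[]} (s≤s x≤m) | count-above-oneTo x m =
  trans (+-comm (m ∸ x) 1) (sym (+-∸-assoc 1 x≤m))
... | no x≰m rewrite filter-reject (x <?_) {suc m} {[]} (λ { (s≤s x≤m) → x≰m x≤m }) | count-above-oneTo x m =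
  trans (+-identityʳ _) (trans (m≤n⇒m∸n≡0 (<⇒≤ (≰⇒> x≰m))) (sym (m≤n⇒m∸n≡0 (≰⇒> x≰m))))

count-below-oneTo-all : ∀ x m → m < x → length (filter (_<? x) (oneTo m)) ≡ m
count-below-oneTo-all x zero _ = refl
count-below-oneTo-all x (suc m) 1+m<x
  rewrite filter-++ (_<? x) (oneTo m) [ suc m ] | length-++ (filter (_<? x) (oneTo m)) {filter (_<? x) [ suc m ]}
        | filter-accept (_<? x) {suc m} {[]} 1+m<x | count-below-oneTo-all x m (<-trans (n<1+n m) 1+m<x) = +-comm m 1

count-below-oneTo : ∀ x m → x ≤ suc m → length (filter (_<? x) (oneTo m)) ≡ pred x
count-below-oneTo x zero x≤1 = sym (n≤0⇒n≡0 (pred-mono-≤ x≤1))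
count-below-oneTo x (suc m) x≤2+m with x ≤? suc m
... | no x≰1+m rewrite ≤-antisym x≤2+m (≰⇒> x≰1+m) = count-below-oneTo-all (suc (suc m)) (suc m) ≤-refl
... | yes x≤1+m
  rewrite filter-++ (_<? x) (oneTo m) [ suc m ] | length-++ (filter (_<? x) (oneTo m)) {filter (_<? x) [ suc m ]}
        | filter-reject (_<? x) {suc m} {[]} (λ 1+m<x → <-irrefl refl (<-≤-trans 1+m<x x≤1+m))
        | count-below-oneTo x m x≤1+m = +-identityʳ (pred x)

fresh-∉ : ∀ {m} p → distinct p ≡ oneTo m → suc m ∉ p
fresh-∉ {m} p p≈ 1+m∈p = n≮n m (proj₂ (∈-oneTo⁻ m (subst (suc m ∈_) p≈ (∈-deduplicate⁺ _≟_ 1+m∈p))))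

seen-∈ : ∀ {m x} p → distinct p ≡ oneTo m → 1 ≤ x → x ≤ m → x ∈ p
seen-∈ {m} p p≈ 1≤x x≤m = ∈-deduplicate⁻ _≟_ p (subst (_ ∈_) (sym p≈) (∈-oneTo⁺ m 1≤x x≤m))

-- A repeated x under maximum m sees m ∸ x larger letters; adding x back gives the cap m.
lbFrom-Growth : ∀ {m w} p (g : Growth m w) → distinct p ≡ oneTo m →
                lbFrom p w + sum (repeated g) ≡ sum (caps m (shape g))
lbFrom-Growth p [] _ = refl
lbFrom-Growth {m} p (new {xs = xs} g) p≈ = begin
  length (filter (suc m <?_) (distinct p)) + lbFrom p′ xs + sum (repeated g)
    ≡⟨ cong (λ k → k + lbFrom p′ xs + sum (repeated g)) none-above ⟩
  lbFrom p′ xs + sum (repeated g)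
    ≡⟨ lbFrom-Growth p′ g (trans (distinct-∷ʳ-∉ p (fresh-∉ p p≈)) (cong (_++ [ suc m ]) p≈)) ⟩
  sum (caps (suc m) (shape g)) ∎
  where
  open ≡-Reasoning
  p′ = p ++ [ suc m ]
  none-above : length (filter (suc m <?_) (distinct p)) ≡ 0
  none-above = trans (cong (λ Ds → length (filter (suc m <?_) Ds)) p≈)
                     (trans (count-above-oneTo (suc m) m) (m≤n⇒m∸n≡0 (n≤1+n m)))
lbFrom-Growth {m} p (old {x = x} {xs} 1≤x x≤m g) p≈ = begin
  length (filter (x <?_) (distinct p)) + lbFrom p′ xs + (x + sum (repeated g))
    ≡⟨ cong (λ k → k + lbFrom p′ xs + (x + sum (repeated g))) above ⟩
  (m ∸ x) + lbFrom p′ xs + (x + sum (repeated g))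
    ≡⟨ interchange (m ∸ x) (lbFrom p′ xs) x (sum (repeated g)) ⟩
  (m ∸ x + x) + (lbFrom p′ xs + sum (repeated g))
    ≡⟨ cong₂ _+_ (m∸n+n≡m x≤m) (lbFrom-Growth p′ g (trans (distinct-∷ʳ-∈ p (seen-∈ p p≈ 1≤x x≤m)) p≈)) ⟩
  m + sum (caps m (shape g)) ∎
  where
  open ≡-Reasoning
  p′ = p ++ [ x ]
  above : length (filter (x <?_) (distinct p)) ≡ m ∸ x
  above = trans (cong (λ Ds → length (filter (x <?_) Ds)) p≈) (count-above-oneTo x m)

firstOccurrenceLs : ℕ → List Bool → ℕ
firstOccurrenceLs m [] = 0
firstOccurrenceLs m (true ∷ s) = m + firstOccurrenceLs (suc m) s
firstOccurrenceLs m (false ∷ s) = firstOccurrenceLs m s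

lsFrom-Growth : ∀ {m w} p (g : Growth m w) → distinct p ≡ oneTo m →
                lsFrom p w ≡ firstOccurrenceLs m (shape g) + sum (map pred (repeated g))
lsFrom-Growth p [] _ = refl
lsFrom-Growth {m} p (new {xs = xs} g) p≈ = begin
  length (filter (_<? suc m) (distinct p)) + lsFrom p′ xs
    ≡⟨ cong₂ _+_ below (lsFrom-Growth p′ g (trans (distinct-∷ʳ-∉ p (fresh-∉ p p≈)) (cong (_++ [ suc m ]) p≈))) ⟩
  m + (firstOccurrenceLs (suc m) (shape g) + sum (map pred (repeated g)))
    ≡⟨ +-assoc m _ _ ⟨
  m + firstOccurrenceLs (suc m) (shape g) + sum (map pred (repeated g)) ∎
  where
  open ≡-Reasoning
  p′ = p ++ [ suc m ]
  below : length (filter (_<? suc m) (distinct p)) ≡ m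
  below = trans (cong (λ Ds → length (filter (_<? suc m) Ds)) p≈) (count-below-oneTo (suc m) m ≤-refl)
lsFrom-Growth {m} p (old {x = x} {xs} 1≤x x≤m g) p≈ = begin
  length (filter (_<? x) (distinct p)) + lsFrom p′ xs
    ≡⟨ cong₂ _+_ below (lsFrom-Growth p′ g (trans (distinct-∷ʳ-∈ p (seen-∈ p p≈ 1≤x x≤m)) p≈)) ⟩
  pred x + (firstOccurrenceLs m (shape g) + sum (map pred (repeated g)))
    ≡⟨ x∙yz≈y∙xz (pred x) (firstOccurrenceLs m (shape g)) (sum (map pred (repeated g))) ⟩
  firstOccurrenceLs m (shape g) + (pred x + sum (map pred (repeated g))) ∎
  where
  open ≡-Reasoning
  p′ = p ++ [ x ]
  below : length (filter (_<? x) (distinct p)) ≡ pred x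
  below = trans (cong (λ Ds → length (filter (_<? x) Ds)) p≈) (count-below-oneTo x m (m≤n⇒m≤1+n x≤m))

lb-determined : ∀ {w w′} (g : Growth 0 w) (g′ : Growth 0 w′) →
                shape g ≡ shape g′ → repeated g ↭ repeated g′ → lb w ≡ lb w′
lb-determined {w} {w′} g g′ s≡s′ rs↭rs′ = +-cancelʳ-≡ (sum (repeated g′)) (lb w) (lb w′) (begin
  lb w + sum (repeated g′)          ≡⟨ cong (lb w +_) (sum-↭ rs↭rs′) ⟨
  lb w + sum (repeated g)           ≡⟨ lbFrom-Growth [] g refl ⟩
  sum (caps 0 (shape g))            ≡⟨ cong (sum ∘ caps 0) s≡s′ ⟩
  sum (caps 0 (shape g′))           ≡⟨ lbFrom-Growth [] g′ refl ⟨
  lb w′ + sum (repeated g′)         ∎)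
  where open ≡-Reasoning

ls-determined : ∀ {w w′} (g : Growth 0 w) (g′ : Growth 0 w′) →
                shape g ≡ shape g′ → repeated g ↭ repeated g′ → ls w ≡ ls w′
ls-determined {w} {w′} g g′ s≡s′ rs↭rs′ = begin
  ls w                                                              ≡⟨ lsFrom-Growth [] g refl ⟩
  firstOccurrenceLs 0 (shape g) + sum (map pred (repeated g))       ≡⟨ cong₂ _+_ (cong (firstOccurrenceLs 0) s≡s′) (sum-↭ (map⁺ pred rs↭rs′)) ⟩
  firstOccurrenceLs 0 (shape g′) + sum (map pred (repeated g′))     ≡⟨ lsFrom-Growth [] g′ refl ⟨
  ls w′                                                             ∎
  where open ≡-Reasoning

noncrossing-determined : ∀ {m w w′} (g : Growth m w) (g′ : Growth m w′) → NonCrossingGrowth g → NonCrossingGrowth g′ →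
                         shape g ≡ shape g′ → repeated g ↭ repeated g′ → w ≡ w′
noncrossing-determined {m} {w} {w′} g g′ nc nc′ s≡s′ rs↭rs′ = begin
  w                                    ≡⟨ assemble-shape-repeated g ⟨
  assemble m (shape g) (repeated g)    ≡⟨ cong₂ (assemble m) s≡s′ rs≡rs′ ⟩
  assemble m (shape g′) (repeated g′)  ≡⟨ assemble-shape-repeated g′ ⟩
  w′                                   ∎
  where
  open ≡-Reasoning
  rs≡rs′ : repeated g ≡ repeated g′
  rs≡rs′ = noncrossing-unique (repeated-≤-caps g)
    (subst (λ s → Pointwise _≤_ (repeated g′) (caps m s)) (sym s≡s′) (repeated-≤-caps g′))
    nc (subst (λ s → NonCrossing (caps m s) (repeated g′)) (sym s≡s′) nc′) rs↭rs′

caps-≥ : ∀ m s → All (m ≤_) (caps m s)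
caps-≥ m [] = []
caps-≥ m (true ∷ s) = All-≤-trans (n≤1+n m) (caps-≥ (suc m) s)
caps-≥ m (false ∷ s) = ≤-refl ∷ caps-≥ m s

caps-sorted : ∀ m s → Sorted (caps m s)
caps-sorted m [] = []
caps-sorted m (true ∷ s) = caps-sorted (suc m) s
caps-sorted m (false ∷ s) = caps-≥ m s ∷ caps-sorted m s

incAssembly : ∀ {w} (g : Growth 0 w) → Assembly 0 (shape g) (isort (repeated g))
incAssembly g = assembly 0 (shape g) (isort (repeated g))
  (isort-≤-pointwise (repeated-≤-caps g) (caps-sorted 0 (shape g)))
  (All-resp-↭ (↭-sym (isort-↭ (repeated g))) (repeated-positive g))

inc-R1221 : ∀ {n w} → IsRGF w → length w ≡ n → InR n p1221 (inc w)
inc-R1221 {n} {w} rgf |w|≡n = subst (InR n p1221) (sym (inc-Growth g))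
  (Growth⇒RGFFrom growth , trans length-≡ (trans (length-shape g) |w|≡n) , sorted⇒avoids-1221 growth sorted)
  where
  g = RGFFrom⇒Growth rgf
  open Assembly (incAssembly g)
  sorted : Sorted (repeated growth)
  sorted = subst Sorted (sym repeated-≡) (isort-sorted (repeated g))

inc-injective : ∀ {w w′} → IsRGF w → IsRGF w′ → Avoids w p1212 → Avoids w′ p1212 → inc w ≡ inc w′ → w ≡ w′
inc-injective rgf rgf′ av av′ inc≡ = noncrossing-determined g g′
  (avoids-1212⇒noncrossing [] [] av g) (avoids-1212⇒noncrossing [] [] av′ g′) s≡s′
  (↭-trans (↭-sym (isort-↭ (repeated g))) (subst (_↭ repeated g′) (sym sorted≡) (isort-↭ (repeated g′))))
  where
  g = RGFFrom⇒Growth rgf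
  g′ = RGFFrom⇒Growth rgf′
  module A = Assembly (incAssembly g)
  module A′ = Assembly (incAssembly g′)
  same : shape A.growth ≡ shape A′.growth × repeated A.growth ≡ repeated A′.growth
  same = shape-repeated-≡ A.growth A′.growth (trans (sym (inc-Growth g)) (trans inc≡ (inc-Growth g′)))
  s≡s′ : shape g ≡ shape g′
  s≡s′ = trans (sym A.shape-≡) (trans (proj₁ same) A′.shape-≡)
  sorted≡ : isort (repeated g) ≡ isort (repeated g′)
  sorted≡ = trans (sym A.repeated-≡) (trans (proj₂ same) A′.repeated-≡)

inc-surjective : ∀ {n u} → IsRGF u → length u ≡ n → Avoids u p1221 → Σ (List ℕ) λ w → InR n p1212 w × inc w ≡ u
inc-surjective {n} {u} rgf |u|≡n av =
  assemble 0 (shape h) arrangement ,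
  (Growth⇒RGFFrom growth , trans length-≡ (trans (length-shape h) |u|≡n) , noncrossing⇒avoids-1212 growth nc) ,
  (begin
    inc (assemble 0 (shape h) arrangement)                      ≡⟨ inc-Growth growth ⟩
    assemble 0 (shape growth) (isort (repeated growth))         ≡⟨ cong₂ (λ s rs → assemble 0 s (isort rs)) shape-≡ repeated-≡ ⟩
    assemble 0 (shape h) (isort arrangement)                    ≡⟨ cong (assemble 0 (shape h)) sorted≡ ⟩
    assemble 0 (shape h) (repeated h)                           ≡⟨ assemble-shape-repeated h ⟩
    u                                                           ∎)
  where
  open ≡-Reasoning
  h = RGFFrom⇒Growth rgf
  open Arrangement (noncrossing-exists (repeated-≤-caps h))
  open Assembly (assembly 0 (shape h) arrangement arrangement-≤
                          (All-resp-↭ (↭-sym ↭-arrangement) (repeated-positive h)))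
  nc : NonCrossingGrowth growth
  nc = subst₂ (λ s rs → NonCrossing (caps 0 s) rs) (sym shape-≡) (sym repeated-≡) noncrossing
  sorted≡ : isort arrangement ≡ repeated h
  sorted≡ = sorted-↭⇒≡ (isort-sorted arrangement) (avoids-1221⇒sorted [] [] av h)
                       (↭-trans (isort-↭ arrangement) ↭-arrangement)

inc-preserves-lb-ls : ∀ {w} → IsRGF w → lb (inc w) ≡ lb w × ls (inc w) ≡ ls w
inc-preserves-lb-ls {w} rgf = subst (λ v → lb v ≡ lb w × ls v ≡ ls w) (sym (inc-Growth g))
  (lb-determined growth g shape-≡ rs↭ , ls-determined growth g shape-≡ rs↭)
  where
  g = RGFFrom⇒Growth rgf
  open Assembly (incAssembly g)
  rs↭ : repeated growth ↭ repeated g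
  rs↭ = subst (_↭ repeated g) (sym repeated-≡) (isort-↭ (repeated g))

proposition6p13 : (n : ℕ) →
    ((w : List ℕ) → InR n p1212 w → InR n p1221 (inc w))
    × ((w w′ : List ℕ) → InR n p1212 w → InR n p1212 w′ → inc w ≡ inc w′ → w ≡ w′)
    × ((u : List ℕ) → InR n p1221 u → Σ (List ℕ) (λ w → InR n p1212 w × inc w ≡ u))
    × ((w : List ℕ) → InR n p1212 w → (lb (inc w) ≡ lb w) × (ls (inc w) ≡ ls w))
proposition6p13 n =
    (λ w (rgf , |w|≡n , _) → inc-R1221 rgf |w|≡n)
  , (λ w w′ (rgf , _ , av) (rgf′ , _ , av′) → inc-injective rgf rgf′ av av′)
  , (λ u (rgf , |u|≡n , av) → inc-surjective rgf |u|≡n av)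
  , (λ w (rgf , _ , _) → inc-preserves-lb-ls rgf)
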